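{- Let $\kappa$ be a cardinal and let $U$ be the graph with vertex set $V(U)=\bigcup_{n<\omega}\kappa^n$ and $\mathbb{Z}$-labelled edge set $E(U)=\{u \xrightarrow{w} u' \mid |u|+w\ge |u'| \text{ and } [\,|u|+w=|u'| \implies u>_{\mathrm{lex}} u'\,]\}$. Then $U$ is $(\kappa,\mathsf{SumToInfinity})$-almost-universal, where $\mathsf{SumToInfinity}=\{w_0w_1\ldots\in\mathbb{Z}^\omega \mid \lim_{k\to\infty}\sum_{i=0}^{k-1}w_i=+\infty\}$.
   Context: For a tuple $u=(u_0,\dots,u_n)$ of ordinals, $|u|$ denotes its length and $u_{<i}=(u_0,\dots,u_{i-1})$; $u>_{\mathrm{lex}}u'$ iff $u'$ is a proper prefix of $u$ or there is $i$ with $u_{<i}=u'_{<i}$ and $u_i>u'_i$. Graphs are directed with edges labelled by integers. A graph satisfies an objective $W\subseteq\mathbb{Z}^\omega$ if the label sequence of every infinite path in it belongs to $W$. A tree is a graph with a root $t_0$ such that every vertex admits a unique path from $t_0$. A morphism from $G$ to $H$ is a map $f:V(G)\to V(H)$ such that for every edge $v\xrightarrow{c}v'$ of $G$, $f(v)\xrightarrow{c}f(v')$ is an edge of $H$; write $G\to H$ if one exists. For a vertex $v_0$ of $T$, $T[v_0]$ is the restriction of $T$ to vertices reachable from $v_0$. For a prefix-independent objective $W$ and cardinal $\kappa$, a graph $U$ is $(\kappa,W)$-almost-universal if $U$ satisfies $W$ and for every tree $T$ with fewer than $\kappa$ vertices satisfying $W$, there is a vertex $v_0$ of $T$ with $T[v_0]\to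 U$. -}

module Defs where

open import Level using (0ℓ)
open import Data.Nat using (ℕ; zero; suc)
open import Data.Integer using (ℤ; +_; _+_; _≤_)
open import Data.List using (List; []; _∷_; length)
open import Data.Product using (Σ; ∃; _×_; _,_)
open import Relation.Binary.PropositionalEquality using (_≡_)
open import Relation.Binary.Structures using (IsStrictTotalOrder)
open import Induction.WellFounded using (WellFounded)
open import Relation.Nullary using (¬_)
open import Function.Bundles using (_↣_)

record Graph : Set₁ where
  field
    V : Set
    E : V → ℤ → V → Set
open Graph public

Objective : Set₁
Objective = (ℕ → ℤ) → Set

record InfPath (G : Graph) : Set where
  field
    vert  : ℕ → V G
    label : ℕ → ℤ
    edge  : ∀ i → E G (vert i) (label i) (vert (suc i))
open InfPath public

Satisfies : Graph → Objective → Set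
Satisfies G W = (p : InfPath G) → W (label p)

data Path (G : Graph) : V G → V G → Set where
  []  : ∀ {u} → Path G u u
  _∷_ : ∀ {u c v w} → E G u c v → Path G v w → Path G u w

IsTree : Graph → Set
IsTree T = Σ (V T) λ t₀ → ∀ v → Σ (Path T t₀ v) λ p → ∀ q → q ≡ p

Hom : Graph → Graph → Set
Hom G H = Σ (V G → V H) λ f → ∀ {v c v'} → E G v c v' → E H (f v) c (f v')

_⟶_ : Graph → Graph → Set
G ⟶ H = Hom G H

-- T[v₀]: restriction of T to the vertices reachable from v₀
-- (a vertex is paired with a witnessing path; in a tree this path is unique)
Restrict : (T : Graph) → V T → Graph
Restrict T v₀ = record
  { V = Σ (V T) (Path T v₀)
  ; E = λ { (v , _) c (v' , _) → E T v c v' } }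

partialSum : (ℕ → ℤ) → ℕ → ℤ
partialSum w zero    = + 0
partialSum w (suc k) = partialSum w k + w k

SumToInfinity : Objective
SumToInfinity w = ∀ (M : ℤ) → ∃ λ (N : ℕ) → ∀ k → N Data.Nat.≤ k → M ≤ partialSum w k

-- Cardinals, modelled as initial ordinals: a type K with a strict
-- well-order _<_ such that K does not inject into any proper initial segment.

record Cardinal : Set₁ where
  field
    K        : Set
    _<_      : K → K → Set
    isSTO    : IsStrictTotalOrder _≡_ _<_
    wf       : WellFounded _<_
    initial  : ∀ (k : K) → ¬ (K ↣ Σ K (λ j → j < k))
open Cardinal public

_<card_ : Set → Cardinal → Set
X <card κ = (X ↣ K κ) × ¬ (K κ ↣ X)

-- prefix independent objective: almost-universality
AlmostUniversal : Cardinal → Objective → Graph → Set₁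
AlmostUniversal κ W U =
  Satisfies U W ×
  ((T : Graph) → IsTree T → V T <card κ → Satisfies T W →
     Σ (V T) λ v₀ → Restrict T v₀ ⟶ U)

module _ (κ : Cardinal) where
  open Cardinal κ renaming (K to Kκ; _<_ to _≺_)

  data LexGt : List Kκ → List Kκ → Set where
    prefix : ∀ {x u} → LexGt (x ∷ u) []
    here   : ∀ {x y u u'} → y ≺ x → LexGt (x ∷ u) (y ∷ u')
    there  : ∀ {x u u'} → LexGt u u' → LexGt (x ∷ u) (x ∷ u')

  UEdge : List Kκ → ℤ → List Kκ → Set
  UEdge u w u' =
    (+ length u' ≤ + length u + w) ×
    (+ length u + w ≡ + length u' → LexGt u u')

  UGraph : Graph
  UGraph = record { V = List Kκ ; E = UEdge }

{-# OPTIONS --safe #-}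
-- Along any path of U the slack |u₀| + (w₀ + … + w_{k-1}) − |u_k| never decreases.  Either it grows
-- without bound, or from some point on every edge is tight, so the vertices form a >lex-descending
-- chain; as κ is well ordered, the lengths in such a chain tend to infinity.  Either way the partial
-- sums do.
--
-- Conversely, the weight d of root paths is a potential on a tree T (d v′ = d v + c along v --c--> v′),
-- and SumToInfinity forbids infinitely many nonempty consecutive paths whose endpoints stay below a
-- fixed level.  Hence some v₀ reaches no vertex of smaller potential, and for each j the relation
-- "reachable through a vertex of potential ≤ j" is well founded; since |T| < κ it has a rank function
-- r_j into κ.  Then v ↦ (r_{d v₀}(v), …, r_{d v}(v)) maps T[v₀] into U: along an edge v --c--> v′ the
-- length grows by exactly c, no coordinate increases, and the coordinate r_{d v} strictly decreases.
module Submission where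

open import Defs hiding (_<_)
open import Level using (0ℓ)
open import Axiom.ExcludedMiddle using (ExcludedMiddle)
open import Axiom.DoubleNegationElimination using (em⇒dne)
open import Data.Nat as ℕ using (ℕ; zero; suc; z≤n; s≤s; _∸_)
import Data.Nat.Properties as ℕP
open import Data.Nat.GeneralisedArithmetic using (fold; iterate; fold-+; iterate-is-fold)
open import Data.Integer as ℤ using (ℤ; +_; -[1+_]; 0ℤ; _+_; _-_; -_; ∣_∣; _≤_; _<_; +≤+; -≤+)
import Data.Integer.Properties as ℤP
open import Data.Integer.Tactic.RingSolver using (solve-∀)
open import Data.List using (List; []; _∷_; length; applyUpTo)
open import Data.List.Properties using (length-applyUpTo)
open import Data.Product using (Σ; ∃; ∃₂; _×_; _,_; proj₁; proj₂)
open import Data.Sum using (_⊎_; inj₁; inj₂; [_,_]′)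
open import Data.Empty using (⊥-elim)
open import Data.Unit using (⊤; tt)
open import Function using (_∘_)
open import Function.Bundles using (_↣_; mk↣)
open import Relation.Binary.PropositionalEquality using (_≡_; refl; sym; trans; cong; subst; subst₂; module ≡-Reasoning)
open import Relation.Binary.Structures using (IsStrictTotalOrder)
open import Relation.Binary.Definitions using (tri<; tri≈; tri>)
open import Relation.Nullary using (¬_; yes; no)
open import Induction.WellFounded using (WellFounded; Acc; acc)
open import Induction.InfiniteDescent using (InfiniteDescendingSequence)

Eventually : (ℕ → Set) → Set
Eventually P = ∃ λ N → ∀ k → N ℕ.≤ k → P k

Diverges : (ℕ → ℤ) → Set
Diverges f = ∀ M → Eventually (λ k → M ≤ f k)

Eventually-map : ∀ {P Q : ℕ → Set} → (∀ k → P k → Q k) → Eventually P → Eventually Q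
Eventually-map P⇒Q (N , ev) = N , λ k N≤k → P⇒Q k (ev k N≤k)

Eventually-shift : ∀ {P : ℕ → Set} N → Eventually (λ m → P (m ℕ.+ N)) → Eventually P
Eventually-shift {P} N (N′ , ev) = N′ ℕ.+ N , λ k N′+N≤k →
  subst P (ℕP.m∸n+n≡m (ℕP.m+n≤o⇒n≤o N′ N′+N≤k)) (ev (k ∸ N) (ℕP.m+n≤o⇒m≤o∸n N′ N′+N≤k))

i≤+∣i∣ : ∀ i → i ≤ + ∣ i ∣
i≤+∣i∣ (+ n)    = ℤP.≤-refl
i≤+∣i∣ -[1+ n ] = -≤+

Diverges-fromℕ : ∀ {g : ℕ → ℕ} → (∀ L → Eventually (λ k → L ℕ.≤ g k)) → Diverges (λ k → + g k)
Diverges-fromℕ g→∞ M = Eventually-map (λ k ∣M∣≤g → ℤP.≤-trans (i≤+∣i∣ M) (+≤+ ∣M∣≤g)) (g→∞ ∣ M ∣)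

Diverges-lowerBound : ∀ {f g : ℕ → ℤ} c → Diverges f → (∀ k → f k + c ≤ g k) → Diverges g
Diverges-lowerBound {f} {g} c f→∞ f+c≤g M = Eventually-map M≤g (f→∞ (M - c))
  where
  open ℤP.≤-Reasoning
  minus-plus : ∀ i j → i ≡ (i - j) + j
  minus-plus = solve-∀
  M≤g : ∀ k → M - c ≤ f k → M ≤ g k
  M≤g k M-c≤f = begin
    M             ≡⟨ minus-plus M c ⟩
    (M - c) + c   ≤⟨ ℤP.+-monoˡ-≤ c M-c≤f ⟩
    f k + c       ≤⟨ f+c≤g k ⟩
    g k           ∎

Nondecreasing : (ℕ → ℤ) → Set
Nondecreasing f = ∀ k → f k ≤ f (suc k)

Nondecreasing-mono : ∀ {f} → Nondecreasing f → ∀ {m n} → m ℕ.≤ n → f m ≤ f n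
Nondecreasing-mono {f} f↑ = go ∘ ℕP.≤⇒≤′
  where
  go : ∀ {m n} → m ℕ.≤′ n → f m ≤ f n
  go ℕ.≤′-refl        = ℤP.≤-refl
  go (ℕ.≤′-step m≤′n) = ℤP.≤-trans (go m≤′n) (f↑ _)

module WellOrder {A : Set} {_≺_ : A → A → Set} (sto : IsStrictTotalOrder _≡_ _≺_) where
  open IsStrictTotalOrder sto public using (compare) renaming (irrefl to ≺-irrefl; trans to ≺-trans)

  _≼_ : A → A → Set
  a ≼ b = ¬ b ≺ a

  ≼-≺-trans : ∀ {a b c} → a ≼ b → b ≺ c → a ≺ c
  ≼-≺-trans {a} {b} {c} a≼b b≺c with compare a c
  ... | tri< a≺c _ _    = a≺c
  ... | tri≈ _ refl _   = ⊥-elim (a≼b b≺c)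
  ... | tri> _ _ c≺a    = ⊥-elim (a≼b (≺-trans b≺c c≺a))

module Lex (κ : Cardinal) where
  open Cardinal κ using () renaming (K to Kκ; _<_ to _≺_)
  open WellOrder (isSTO κ)

  LexDescending : (ℕ → List Kκ) → Set
  LexDescending u = ∀ k → LexGt κ (u k) (u (suc k))

  LexGt-uncons : ∀ {u v} → LexGt κ u v → ∃₂ λ x a → u ≡ x ∷ a
  LexGt-uncons prefix    = _ , _ , refl
  LexGt-uncons (here _)  = _ , _ , refl
  LexGt-uncons (there _) = _ , _ , refl

  LexGt-head : ∀ {x y a b} → LexGt κ (x ∷ a) (y ∷ b) → y ≼ x
  LexGt-head (here y≺x) x≺y = ≺-irrefl refl (≺-trans x≺y y≺x)
  LexGt-head (there _)  x≺x = ≺-irrefl refl x≺x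

  LexGt-tail : ∀ {x y a b} → LexGt κ (x ∷ a) (y ∷ b) → y ≡ x → LexGt κ a b
  LexGt-tail (here y≺x) refl = ⊥-elim (≺-irrefl refl y≺x)
  LexGt-tail (there a>b) _   = a>b

  applyUpTo-LexGt : ∀ {σ σ′ : ℕ → Kκ} {i} n n′ → (∀ j → σ′ j ≼ σ j) → σ′ i ≺ σ i → i ℕ.< n →
                    LexGt κ (applyUpTo σ n) (applyUpTo σ′ n′)
  applyUpTo-LexGt (suc n) zero     _     _    _ = prefix
  applyUpTo-LexGt {i = zero} (suc n) (suc n′) _ σ′i≺σi _ = here σ′i≺σi
  applyUpTo-LexGt {σ} {σ′} {suc i} (suc n) (suc n′) σ′≼σ σ′i≺σi (s≤s i<n) with compare (σ′ 0) (σ 0)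
  ... | tri< σ′0≺σ0 _ _ = here σ′0≺σ0
  ... | tri≈ _ σ′0≡σ0 _ = subst (λ x → LexGt κ (applyUpTo σ (suc n)) (x ∷ applyUpTo (σ′ ∘ suc) n′))
                            (sym σ′0≡σ0) (there (applyUpTo-LexGt n n′ (σ′≼σ ∘ suc) σ′i≺σi i<n))
  ... | tri> _ _ σ0≺σ′0 = ⊥-elim (σ′≼σ 0 σ0≺σ′0)

module _ {G : Graph} where
  weight : ∀ {u v} → Path G u v → ℤ
  weight []                  = 0ℤ
  weight (_∷_ {c = c} _ p)  = c + weight p

  edgeCount : ∀ {u v} → Path G u v → ℕ
  edgeCount []      = 0
  edgeCount (_ ∷ p) = suc (edgeCount p)

  _∷ʳ_ : ∀ {u v c w} → Path G u v → E G v c w → Path G u w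
  []       ∷ʳ e = e ∷ []
  (e′ ∷ p) ∷ʳ e = e′ ∷ (p ∷ʳ e)

  _++ᵖ_ : ∀ {u v w} → Path G u v → Path G v w → Path G u w
  []      ++ᵖ q = q
  (e ∷ p) ++ᵖ q = e ∷ (p ++ᵖ q)

  weight-∷ʳ : ∀ {u v c w} (p : Path G u v) (e : E G v c w) → weight (p ∷ʳ e) ≡ weight p + c
  weight-∷ʳ {c = c} []       _ = trans (ℤP.+-identityʳ c) (sym (ℤP.+-identityˡ c))
  weight-∷ʳ (_∷_ {c = c′} _ p) e = trans (cong (λ w → c′ + w) (weight-∷ʳ p e)) (sym (ℤP.+-assoc c′ (weight p) _))

Path⁺ : (G : Graph) → V G → V G → Set
Path⁺ G u w = Σ ℤ λ c → Σ (V G) λ v → E G u c v × Path G v w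

length⁺ : ∀ {G u w} → Path⁺ G u w → ℕ
length⁺ (_ , _ , _ , p) = suc (edgeCount p)

_⁺++_ : ∀ {G u v w} → Path⁺ G u v → Path G v w → Path⁺ G u w
(c , v , e , p) ⁺++ q = c , v , e , (p ++ᵖ q)

module Concatenation {G : Graph} (x : ℕ → V G) (step : ∀ n → Path⁺ G (x n) (x (suc n))) where
  Cursor : Set
  Cursor = Σ ℕ λ n → Σ (V G) λ u → Path⁺ G u (x (suc n))

  start : ℕ → Cursor
  start n = n , x n , step n

  advance : Cursor → Cursor
  advance (n , _ , _ , _ , _ , [])     = start (suc n)
  advance (n , _ , _ , v , _ , e ∷ p)  = n , v , _ , _ , e , p

  vertex : Cursor → V G
  vertex (_ , u , _) = u

  nextLabel : Cursor → ℤ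
  nextLabel (_ , _ , c , _) = c

  advance-edge : ∀ s → E G (vertex s) (nextLabel s) (vertex (advance s))
  advance-edge (_ , _ , _ , _ , e , [])    = e
  advance-edge (_ , _ , _ , _ , e , _ ∷ _) = e

  cursor : ℕ → Cursor
  cursor = fold (start 0) advance

  path : InfPath G
  path = record { vert = vertex ∘ cursor ; label = nextLabel ∘ cursor ; edge = advance-edge ∘ cursor }

  advance-segment : ∀ n {u c v} (e : E G u c v) (p : Path G v (x (suc n))) →
                    iterate advance (n , u , c , v , e , p) (suc (edgeCount p)) ≡ start (suc n)
  advance-segment n e []       = refl
  advance-segment n e (e′ ∷ p) = advance-segment n e′ p

  advance-step : ∀ n → iterate advance (start n) (length⁺ (step n)) ≡ start (suc n)
  advance-step n = advance-segment n (proj₁ (proj₂ (proj₂ (step n)))) (proj₂ (proj₂ (proj₂ (step n))))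

  reaches : ∀ n → ∃ λ k → n ℕ.≤ k × cursor k ≡ start n
  reaches zero    = 0 , z≤n , refl
  reaches (suc n) with reaches n
  ... | k , n≤k , at = length⁺ (step n) ℕ.+ k , s≤s (ℕP.≤-trans n≤k (ℕP.m≤n+m k _)) , (begin
    fold (start 0) advance (length⁺ (step n) ℕ.+ k)   ≡⟨ fold-+ (start 0) advance (length⁺ (step n)) ⟩
    fold (cursor k) advance (length⁺ (step n))        ≡⟨ cong (λ s → fold s advance (length⁺ (step n))) at ⟩
    fold (start n) advance (length⁺ (step n))         ≡⟨ iterate-is-fold (start n) advance (length⁺ (step n)) ⟩
    iterate advance (start n) (length⁺ (step n))      ≡⟨ advance-step n ⟩
    start (suc n)                                    ∎)
    where open ≡-Reasoning

  visits : ∀ n → ∃ λ k → n ℕ.≤ k × vert path k ≡ x n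
  visits n with reaches n
  ... | k , n≤k , at = k , n≤k , cong vertex at

IsPotential : (G : Graph) → (V G → ℤ) → Set
IsPotential G d = ∀ {v c v′} → E G v c v′ → d v′ ≡ d v + c

tree-potential : (T : Graph) → IsTree T → Σ (V T → ℤ) (IsPotential T)
tree-potential T (t₀ , unique) = weight ∘ rootPath , λ {v} {c} {v′} e → begin
  weight (rootPath v′)        ≡⟨ cong weight (sym (proj₂ (unique v′) (rootPath v ∷ʳ e))) ⟩
  weight (rootPath v ∷ʳ e)    ≡⟨ weight-∷ʳ (rootPath v) e ⟩
  weight (rootPath v) + c     ∎
  where
  open ≡-Reasoning
  rootPath : ∀ v → Path T t₀ v
  rootPath v = proj₁ (unique v)

potential-partialSum : ∀ {G d} → IsPotential G d → (p : InfPath G) →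
                       ∀ k → d (vert p k) ≡ d (vert p 0) + partialSum (label p) k
potential-partialSum pot p zero    = sym (ℤP.+-identityʳ _)
potential-partialSum {d = d} pot p (suc k) = begin
  d (vert p (suc k))                                       ≡⟨ pot (edge p k) ⟩
  d (vert p k) + label p k                                 ≡⟨ cong (_+ label p k) (potential-partialSum pot p k) ⟩
  d (vert p 0) + partialSum (label p) k + label p k        ≡⟨ ℤP.+-assoc (d (vert p 0)) _ _ ⟩
  d (vert p 0) + partialSum (label p) (suc k)              ∎
  where open ≡-Reasoning

noBoundedChain : ∀ {G d} → IsPotential G d → Satisfies G SumToInfinity →
                 (x : ℕ → V G) → (∀ n → Path⁺ G (x n) (x (suc n))) → ∀ j → ¬ (∀ n → d (x n) ≤ j)
noBoundedChain {d = d} pot sat x step j bounded = ℤP.<-irrefl refl (ℤP.suc[i]≤j⇒i<j (begin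
  + 1 + j                                ≡⟨ recentre d₀ j ⟩
  d₀ + (+ 1 + (j - d₀))                  ≤⟨ ℤP.+-monoʳ-≤ d₀ (above k N≤k) ⟩
  d₀ + partialSum (label path) k         ≡⟨ sym (potential-partialSum pot path k) ⟩
  d (vert path k)                        ≡⟨ cong d path-k≡xN ⟩
  d (x N)                                ≤⟨ bounded N ⟩
  j                                      ∎))
  where
  open Concatenation x step
  open ℤP.≤-Reasoning
  recentre : ∀ a j → + 1 + j ≡ a + (+ 1 + (j - a))
  recentre = solve-∀
  d₀ = d (vert path 0)
  N = proj₁ (sat path (+ 1 + (j - d₀)))
  above = proj₂ (sat path (+ 1 + (j - d₀)))
  k = proj₁ (visits N)
  N≤k = proj₁ (proj₂ (visits N))
  path-k≡xN = proj₂ (proj₂ (visits N))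

module _ (em : ExcludedMiddle 0ℓ) where
  private
    dne : ∀ {P : Set} → ¬ ¬ P → P
    dne = em⇒dne em

  noInfiniteDescent⇒wf : ∀ {A : Set} {Q : A → A → Set} →
                         (∀ f → ¬ InfiniteDescendingSequence Q f) → WellFounded Q
  noInfiniteDescent⇒wf {A} {Q} noDescent x = dne λ ¬acc →
    noDescent (proj₁ ∘ chain ¬acc) (λ n → proj₁ (proj₂ (descend (proj₂ (chain ¬acc n)))))
    where
    descend : ∀ {y} → ¬ Acc Q y → ∃ λ z → Q z y × ¬ Acc Q z
    descend ¬acc = dne λ stuck → ¬acc (acc λ {z} z<y → dne λ ¬acc-z → stuck (z , z<y , ¬acc-z))
    chain : ∀ {y} → ¬ Acc Q y → ℕ → Σ A (¬_ ∘ Acc Q)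
    chain ¬acc zero    = _ , ¬acc
    chain ¬acc (suc n) = proj₁ next , proj₂ (proj₂ next)
      where next = descend (proj₂ (chain ¬acc n))

  minimal : ∀ {A : Set} {Q : A → A → Set} → WellFounded Q → ∀ {P : A → Set} {x} → P x →
            ∃ λ m → P m × ∀ y → Q y m → ¬ P y
  minimal {Q = Q} wf {P} {x} px = go (wf x) px
    where
    go : ∀ {x} → Acc Q x → P x → ∃ λ m → P m × ∀ y → Q y m → ¬ P y
    go {x} (acc rs) px with em {∃ λ y → Q y x × P y}
    ... | yes (y , y<x , py) = go (rs y<x) py
    ... | no none            = x , px , λ y y<x py → none (y , y<x , py)

  Nondecreasing-dichotomy : ∀ {f} → Nondecreasing f → Eventually (λ k → f (suc k) ≡ f k) ⊎ Diverges f
  Nondecreasing-dichotomy {f} f↑ with em {Eventually (λ k → f (suc k) ≡ f k)}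
  ... | yes stable = inj₁ stable
  ... | no ¬stable = inj₂ λ M → let K , f0+∣M-f0∣≤fK = climb ∣ M - f 0 ∣ in
    K , λ k K≤k → begin
      M                       ≡⟨ recentre (f 0) M ⟩
      f 0 + (M - f 0)         ≤⟨ ℤP.+-monoʳ-≤ (f 0) (i≤+∣i∣ (M - f 0)) ⟩
      f 0 + + ∣ M - f 0 ∣     ≤⟨ f0+∣M-f0∣≤fK ⟩
      f K                     ≤⟨ Nondecreasing-mono f↑ K≤k ⟩
      f k                     ∎
    where
    open ℤP.≤-Reasoning
    recentre : ∀ a i → i ≡ a + (i - a)
    recentre = solve-∀
    shift-suc : ∀ a i → a + (+ 1 + i) ≡ + 1 + (a + i)
    shift-suc = solve-∀
    jump : ∀ N → ∃ λ k → N ℕ.≤ k × f k < f (suc k)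
    jump N = dne λ noJump → ¬stable (N , λ k N≤k →
      sym (ℤP.≤∧≮⇒≡ (f↑ k) (λ fk<fk+1 → noJump (k , N≤k , fk<fk+1))))
    climb : ∀ g → ∃ λ K → f 0 + + g ≤ f K
    climb zero    = 0 , ℤP.≤-reflexive (ℤP.+-identityʳ (f 0))
    climb (suc g) with climb g
    ... | K , f0+g≤fK with jump K
    ... | k , K≤k , fk<fk+1 = suc k , (begin
      f 0 + + suc g           ≡⟨ shift-suc (f 0) (+ g) ⟩
      ℤ.suc (f 0 + + g)       ≤⟨ ℤP.i<j⇒suc[i]≤j (ℤP.≤-<-trans f0+g≤fk fk<fk+1) ⟩
      f (suc k)               ∎)
      where f0+g≤fk = ℤP.≤-trans f0+g≤fK (Nondecreasing-mono f↑ K≤k)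

  module _ {A : Set} {_≺_ : A → A → Set} (sto : IsStrictTotalOrder _≡_ _≺_) (≺-wf : WellFounded _≺_) where
    open WellOrder sto

    nonIncreasing⇒eventuallyConstant : (h : ℕ → A) → (∀ k → h (suc k) ≼ h k) → Eventually (λ k → h (suc k) ≡ h k)
    nonIncreasing⇒eventuallyConstant h = go h (≺-wf (h 0))
      where
      go : (h : ℕ → A) → Acc _≺_ (h 0) → (∀ k → h (suc k) ≼ h k) → Eventually (λ k → h (suc k) ≡ h k)
      go h (acc rs) h↓ with em {∃ λ k → h k ≺ h 0}
      ... | yes (k , hk≺h0) = Eventually-shift k (go (λ m → h (m ℕ.+ k)) (rs hk≺h0) (λ m → h↓ (m ℕ.+ k)))
      ... | no ¬drop        = 0 , λ k _ → trans (≡h0 (suc k)) (sym (≡h0 k))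
        where
        ≡h0 : ∀ k → h k ≡ h 0
        ≡h0 zero    = refl
        ≡h0 (suc k) with compare (h (suc k)) (h 0)
        ... | tri< hk+1≺h0 _ _ = ⊥-elim (¬drop (suc k , hk+1≺h0))
        ... | tri≈ _ hk+1≡h0 _ = hk+1≡h0
        ... | tri> _ _ h0≺hk+1 = ⊥-elim (h↓ k (subst (_≺ h (suc k)) (sym (≡h0 k)) h0≺hk+1))

    module Rank {X : Set} (small : ¬ (A ↣ X)) {R : X → X → Set} (R-wf : WellFounded R) where
      private
        data RankBound (k : A) (x : X) : Set where
          bound : (∀ y → R y x → ∃ λ j → j ≺ k × RankBound j y) → RankBound k x

        Gap : A → Set
        Gap k = ∀ x → RankBound k x → ∃ λ j → j ≺ k × RankBound j x

        -- If no k were a gap, choosing for each k an x whose least rank bound is k would inject A into X.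
        gap : ∃ Gap
        gap = dne λ noGap → small (mk↣ {to = proj₁ ∘ exact noGap} (injective noGap))
          where
          Exact : A → X → Set
          Exact k x = RankBound k x × ¬ (∃ λ j → j ≺ k × RankBound j x)
          exact : ¬ ∃ Gap → ∀ k → Σ X (Exact k)
          exact noGap k = dne λ ¬exact → noGap (k , λ x b → dne λ ¬below → ¬exact (x , b , ¬below))
          injective : ∀ noGap {k k′} → proj₁ (exact noGap k) ≡ proj₁ (exact noGap k′) → k ≡ k′
          injective noGap {k} {k′} same with exact noGap k | exact noGap k′ | compare k k′
          ... | _ , b , _ | _ , _ , ¬below′ | tri< k≺k′ _ _ =
            ⊥-elim (¬below′ (k , k≺k′ , subst (RankBound k) same b))
          ... | _ | _ | tri≈ _ k≡k′ _ = k≡k′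
          ... | _ , _ , ¬below | _ , b′ , _ | tri> _ _ k′≺k =
            ⊥-elim (¬below (k′ , k′≺k , subst (RankBound k′) (sym same) b′))

        boundedBelowGap : ∀ {x} → Acc R x → ∃ λ j → j ≺ proj₁ gap × RankBound j x
        boundedBelowGap {x} (acc rs) = proj₂ gap x (bound λ y y<x → boundedBelowGap (rs y<x))

        leastBound : ∀ x → ∃ λ k → RankBound k x × ∀ j → j ≺ k → ¬ RankBound j x
        leastBound x = minimal ≺-wf (proj₂ (proj₂ (boundedBelowGap (R-wf x))))

      rank : X → A
      rank x = proj₁ (leastBound x)

      rank-strict : ∀ {x y} → R y x → rank y ≺ rank x
      rank-strict {x} {y} y<x with proj₁ (proj₂ (leastBound x))
      ... | bound below with below y y<x
      ... | j , j≺rank-x , bj = ≼-≺-trans (λ j≺rank-y → proj₂ (proj₂ (leastBound y)) j j≺rank-y bj) j≺rank-x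

      rank-mono : ∀ {x x′} → (∀ y → R y x′ → R y x) → rank x′ ≼ rank x
      rank-mono {x} {x′} pred⊆ rank-x≺rank-x′ =
        proj₂ (proj₂ (leastBound x′)) (rank x) rank-x≺rank-x′
          (bound λ y y<x′ → rank y , rank-strict (pred⊆ y y<x′) , proj₁ (proj₂ (leastBound y)))

  module _ (κ : Cardinal) where
    open Cardinal κ using () renaming (K to Kκ)
    open Lex κ

    lexDescending⇒lengthDiverges : ∀ L (u : ℕ → List Kκ) → LexDescending u → Eventually (λ k → L ℕ.≤ length (u k))
    lexDescending⇒lengthDiverges zero    u _    = 0 , λ _ _ → z≤n
    lexDescending⇒lengthDiverges (suc L) u desc =
      Eventually-map (λ k L≤tl → subst (λ l → suc L ℕ.≤ length l) (sym (u≡ k)) (s≤s L≤tl))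
        (Eventually-shift N (lexDescending⇒lengthDiverges L (λ m → tl (m ℕ.+ N)) tl-desc))
      where
      hd : ℕ → Kκ
      hd k = proj₁ (LexGt-uncons (desc k))
      tl : ℕ → List Kκ
      tl k = proj₁ (proj₂ (LexGt-uncons (desc k)))
      u≡ : ∀ k → u k ≡ hd k ∷ tl k
      u≡ k = proj₂ (proj₂ (LexGt-uncons (desc k)))
      desc∷ : ∀ k → LexGt κ (hd k ∷ tl k) (hd (suc k) ∷ tl (suc k))
      desc∷ k = subst₂ (LexGt κ) (u≡ k) (u≡ (suc k)) (desc k)
      hd-stable : Eventually (λ k → hd (suc k) ≡ hd k)
      hd-stable = nonIncreasing⇒eventuallyConstant (isSTO κ) (wf κ) hd (LexGt-head ∘ desc∷)
      N = proj₁ hd-stable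
      tl-desc : LexDescending (λ m → tl (m ℕ.+ N))
      tl-desc m = LexGt-tail (desc∷ (m ℕ.+ N)) (proj₂ hd-stable (m ℕ.+ N) (ℕP.m≤n+m N m))

    module Slack (p : InfPath (UGraph κ)) where
      open ℤP.≤-Reasoning

      u : ℕ → List Kκ
      u = vert p

      len : ℕ → ℤ
      len k = + length (u k)

      slack : ℕ → ℤ
      slack k = (len 0 + partialSum (label p) k) - len k

      private
        gain-identity : ∀ l₀ s c l l′ → (l + c) - l′ ≡ ((l₀ + (s + c)) - l′) - ((l₀ + s) - l)
        gain-identity = solve-∀
        split-identity : ∀ l₀ s l → s ≡ ((l₀ + s) - l) + (l - l₀)
        split-identity = solve-∀
        start-identity : ∀ l₀ → (l₀ + 0ℤ) - l₀ ≡ 0ℤ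
        start-identity = solve-∀

      gain : ∀ k → (len k + label p k) - len (suc k) ≡ slack (suc k) - slack k
      gain k = gain-identity (len 0) (partialSum (label p) k) (label p k) (len k) (len (suc k))

      split : ∀ k → partialSum (label p) k ≡ slack k + (len k - len 0)
      split k = split-identity (len 0) (partialSum (label p) k) (len k)

      slack↑ : Nondecreasing slack
      slack↑ k = ℤP.0≤i-j⇒j≤i (subst (0ℤ ≤_) (gain k) (ℤP.i≤j⇒0≤j-i (proj₁ (edge p k))))

      slack≥0 : ∀ k → 0ℤ ≤ slack k
      slack≥0 k = ℤP.≤-trans (ℤP.≤-reflexive (sym (start-identity (len 0)))) (Nondecreasing-mono slack↑ {0} {k} z≤n)

      stableSlack⇒sumToInfinity : Eventually (λ k → slack (suc k) ≡ slack k) → SumToInfinity (label p)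
      stableSlack⇒sumToInfinity (N , stable) = Diverges-lowerBound (- len 0) len→∞ λ k → begin
          len k - len 0               ≤⟨ ℤP.i≤j+i (len k - len 0) (slack k) ⦃ ℤ.nonNegative (slack≥0 k) ⦄ ⟩
          slack k + (len k - len 0)   ≡⟨ sym (split k) ⟩
          partialSum (label p) k      ∎
        where
        tight : ∀ k → N ℕ.≤ k → len k + label p k ≡ len (suc k)
        tight k N≤k = ℤP.i-j≡0⇒i≡j _ _ (trans (gain k)
                        (trans (cong (_- slack k) (stable k N≤k)) (ℤP.+-inverseʳ (slack k))))
        lexDescending : LexDescending (λ m → u (m ℕ.+ N))
        lexDescending m = proj₂ (edge p (m ℕ.+ N)) (tight (m ℕ.+ N) (ℕP.m≤n+m N m))
        len→∞ : Diverges len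
        len→∞ = Diverges-fromℕ λ L → Eventually-shift N (lexDescending⇒lengthDiverges L _ lexDescending)

      slackDiverges⇒sumToInfinity : Diverges slack → SumToInfinity (label p)
      slackDiverges⇒sumToInfinity slack→∞ = Diverges-lowerBound (- len 0) slack→∞ λ k → begin
        slack k - len 0               ≤⟨ ℤP.+-monoʳ-≤ (slack k) (ℤP.i≤j+i (- len 0) (len k)) ⟩
        slack k + (len k - len 0)     ≡⟨ sym (split k) ⟩
        partialSum (label p) k        ∎

    UGraph-satisfies : Satisfies (UGraph κ) SumToInfinity
    UGraph-satisfies p = [ stableSlack⇒sumToInfinity , slackDiverges⇒sumToInfinity ]′ (Nondecreasing-dichotomy slack↑)
      where open Slack p

  module _ {G : Graph} {d : V G → ℤ} (pot : IsPotential G d) (sat : Satisfies G SumToInfinity) where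
    ReachableBelow : V G → V G → Set
    ReachableBelow y x = Path⁺ G x y × d y < d x

    ReachableBelow-wf : WellFounded ReachableBelow
    ReachableBelow-wf = noInfiniteDescent⇒wf λ x desc →
      noBoundedChain pot sat x (proj₁ ∘ desc) (d (x 0)) (belowStart desc)
      where
      belowStart : ∀ {x} → InfiniteDescendingSequence ReachableBelow x → ∀ n → d (x n) ≤ d (x 0)
      belowStart desc zero    = ℤP.≤-refl
      belowStart desc (suc n) = ℤP.≤-trans (ℤP.<⇒≤ (proj₂ (desc n))) (belowStart desc n)

    ReachableThrough≤ : ℤ → V G → V G → Set
    ReachableThrough≤ j y x = Σ (V G) λ z → Path G x z × d z ≤ j × Path⁺ G z y

    ReachableThrough≤-wf : ∀ j → WellFounded (ReachableThrough≤ j)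
    ReachableThrough≤-wf j = noInfiniteDescent⇒wf λ x desc →
      noBoundedChain pot sat (via desc) (viaStep desc) j (proj₁ ∘ proj₂ ∘ proj₂ ∘ desc)
      where
      via : ∀ {x} → InfiniteDescendingSequence (ReachableThrough≤ j) x → ℕ → V G
      via desc = proj₁ ∘ desc
      viaStep : ∀ {x} (desc : InfiniteDescendingSequence (ReachableThrough≤ j) x) →
                ∀ n → Path⁺ G (via desc n) (via desc (suc n))
      viaStep desc n = proj₂ (proj₂ (proj₂ (desc n))) ⁺++ proj₁ (proj₂ (desc (suc n)))

    module Embedding (κ : Cardinal) (small : ¬ (K κ ↣ V G)) (t : V G) where
      open Cardinal κ using () renaming (K to Kκ; _<_ to _≺_)
      open WellOrder (isSTO κ)
      open Lex κ

      lowest : ∃ λ v₀ → ⊤ × ∀ y → ReachableBelow y v₀ → ¬ ⊤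
      lowest = minimal ReachableBelow-wf {x = t} tt

      v₀ : V G
      v₀ = proj₁ lowest

      v₀-lowest : ∀ {v} → Path G v₀ v → d v₀ ≤ d v
      v₀-lowest []      = ℤP.≤-refl
      v₀-lowest (e ∷ p) = ℤP.≮⇒≥ λ below → proj₂ (proj₂ lowest) _ ((_ , _ , e , p) , below) tt

      rank : ℤ → V G → Kκ
      rank j = Rank.rank (isSTO κ) (wf κ) small (ReachableThrough≤-wf j)

      rank-mono : ∀ {v c v′} j → E G v c v′ → rank j v′ ≼ rank j v
      rank-mono j e = Rank.rank-mono (isSTO κ) (wf κ) small (ReachableThrough≤-wf j)
                        λ { y (z , q , z≤j , r) → z , e ∷ q , z≤j , r }

      rank-drop : ∀ {v c v′ j} → E G v c v′ → d v ≤ j → rank j v′ ≺ rank j v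
      rank-drop {v} {c} {v′} e v≤j = Rank.rank-strict (isSTO κ) (wf κ) small (ReachableThrough≤-wf _)
                                       (v , [] , v≤j , c , v′ , e , [])

      height : V G → ℕ
      height v = ∣ d v - d v₀ ∣

      +height : ∀ {v} → Path G v₀ v → + height v ≡ d v - d v₀
      +height p = ℤP.0≤i⇒+∣i∣≡i (ℤP.i≤j⇒0≤j-i (v₀-lowest p))

      height-edge : ∀ {v c v′} → Path G v₀ v → Path G v₀ v′ → E G v c v′ → + height v′ ≡ + height v + c
      height-edge {v} {c} {v′} p p′ e = begin
        + height v′        ≡⟨ +height p′ ⟩
        d v′ - d v₀        ≡⟨ cong (_- d v₀) (pot e) ⟩
        (d v + c) - d v₀   ≡⟨ swap (d v) c (d v₀) ⟩
        (d v - d v₀) + c   ≡⟨ cong (_+ c) (sym (+height p)) ⟩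
        + height v + c     ∎
        where
        open ≡-Reasoning
        swap : ∀ a c b → (a + c) - b ≡ (a - b) + c
        swap = solve-∀

      ranks : V G → ℕ → Kκ
      ranks v i = rank (d v₀ + + i) v

      code : V G → List Kκ
      code v = applyUpTo (ranks v) (suc (height v))

      code-edge : ∀ {v c v′} → Path G v₀ v → Path G v₀ v′ → E G v c v′ → UEdge κ (code v) c (code v′)
      code-edge {v} {c} {v′} p p′ e = ℤP.≤-reflexive length-code , λ _ → code-LexGt
        where
        open ≡-Reasoning
        recentre : ∀ a b → a ≡ b + (a - b)
        recentre = solve-∀
        length-code : + length (code v′) ≡ + length (code v) + c
        length-code = begin
          + length (code v′)       ≡⟨ cong +_ (length-applyUpTo (ranks v′) (suc (height v′))) ⟩
          + 1 + + height v′        ≡⟨ cong (λ h → + 1 + h) (height-edge p p′ e) ⟩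
          + 1 + (+ height v + c)   ≡⟨ sym (ℤP.+-assoc (+ 1) (+ height v) c) ⟩
          + suc (height v) + c     ≡⟨ cong (λ n → + n + c) (sym (length-applyUpTo (ranks v) (suc (height v)))) ⟩
          + length (code v) + c    ∎
        v-at-height : d v ≡ d v₀ + + height v
        v-at-height = trans (recentre (d v) (d v₀)) (cong (λ h → d v₀ + h) (sym (+height p)))
        code-LexGt : LexGt κ (code v) (code v′)
        code-LexGt = applyUpTo-LexGt {ranks v} {ranks v′} (suc (height v)) (suc (height v′))
                       (λ i → rank-mono (d v₀ + + i) e) (rank-drop e (ℤP.≤-reflexive v-at-height)) (ℕP.n<1+n (height v))

      embedding : Restrict G v₀ ⟶ UGraph κ
      embedding = code ∘ proj₁ , λ { {v , p} {c} {v′ , p′} e → code-edge p p′ e }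

theorem5 : ExcludedMiddle 0ℓ → (κ : Cardinal) →
    AlmostUniversal κ SumToInfinity (UGraph κ)
theorem5 em κ = UGraph-satisfies em κ , λ T tree smaller sat →
  let d , pot = tree-potential T tree
      open Embedding em pot sat κ (proj₂ smaller) (proj₁ tree)
  in v₀ , embedding
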